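{- Let $H$ and $K$ be finite groups. Let $X$ be a finite connected graph which is a normal bi-Cayley graph over $H$, i.e. $\mathrm{Aut}(X)$ has a normal subgroup $B\cong H$ acting semiregularly on $V(X)$ with two orbits. Let $Y=\mathrm{Cay}(K,T)$ be a finite connected Cayley graph on $K$ which is normal, i.e. $R(K)\trianglelefteq \mathrm{Aut}(Y)$. If $X$ and $Y$ are relatively prime with respect to the Cartesian product, then $X\,\square\, Y$ is a normal bi-Cayley graph over $H\times K$ (namely $B\times R(K)$ is a normal subgroup of $\mathrm{Aut}(X\square Y)$ acting semiregularly on $V(X)\times V(Y)$ with two orbits).
   Context: For a group $K$ and inverse-closed $T\subseteq K\setminus\{1\}$, $\mathrm{Cay}(K,T)$ has vertex set $K$ and edges $\{g,tg\}$, $g\in K$, $t\in T$; $R(K)=\{R(g): x\mapsto xg\}$ is a regular subgroup of its automorphism group. A permutation group is semiregular if all point stabilizers are trivial. The Cartesian product $X\square Y$ has vertex set $V(X)\times V(Y)$, with $(u,x)\sim(v,y)$ iff ($u=v$ and $x\sim y$ in $Y$) or ($x=y$ and $u\sim v$ in $X$). A nontrivial graph is prime if it is not isomorphic to a Cartesian product of two smaller graphs; every connected finite graph has a prime factor decomposition with respect to $\square$, unique up to isomorphism and order of factors. Two nontrivial graphs are relatively prime if they have no nontrivial common Cartesian factor. -}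

module Defs where

open import Level using (0ℓ)
open import Data.Nat using (ℕ)
open import Data.Fin using (Fin)
open import Data.Product using (Σ; ∃; ∃-syntax; _×_; _,_; proj₁; proj₂)
open import Data.Sum using (_⊎_)
open import Data.Empty using (⊥)
open import Relation.Nullary using (¬_)
open import Relation.Unary using (Pred; _∈_; _∉_)
open import Relation.Binary.PropositionalEquality
  using (_≡_; _≢_; refl; sym; trans; cong; cong₂; isEquivalence)
open import Relation.Binary.Construct.Closure.ReflexiveTransitive using (Star)
open import Function.Bundles using (_↔_; _⇔_)
open import Algebra.Core using (Op₁; Op₂)
import Algebra.Structures as AS

Finite : Set → Set
Finite A = ∃[ n ] (A ↔ Fin n)

record Grp : Set₁ where
  infixl 7 _∙_
  field
    Carrier : Set
    _∙_     : Op₂ Carrier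
    ε       : Carrier
    _⁻¹     : Op₁ Carrier
    isGroup : AS.IsGroup _≡_ _∙_ ε _⁻¹

El : Grp → Set
El = Grp.Carrier

_×G_ : Grp → Grp → Grp
H ×G K = record
  { Carrier = Grp.Carrier H × Grp.Carrier K
  ; _∙_ = λ { (a , b) (c , d) → (a H.∙ c , b K.∙ d) }
  ; ε = (H.ε , K.ε)
  ; _⁻¹ = λ { (a , b) → (a H.⁻¹ , b K.⁻¹) }
  ; isGroup = record
    { isMonoid = record
      { isSemigroup = record
        { isMagma = record
          { isEquivalence = isEquivalence
          ; ∙-cong = λ { refl refl → refl } }
        ; assoc = λ { (a , b) (c , d) (e , f) →
                        cong₂ _,_ (HG.assoc a c e) (KG.assoc b d f) } }
      ; identity = (λ { (a , b) → cong₂ _,_ (HG.identityˡ a) (KG.identityˡ b) })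
                 , (λ { (a , b) → cong₂ _,_ (HG.identityʳ a) (KG.identityʳ b) }) }
    ; inverse = (λ { (a , b) → cong₂ _,_ (HG.inverseˡ a) (KG.inverseˡ b) })
              , (λ { (a , b) → cong₂ _,_ (HG.inverseʳ a) (KG.inverseʳ b) })
    ; ⁻¹-cong = λ { refl → refl } } }
  where
  module H = Grp H
  module K = Grp K
  module HG = AS.IsGroup H.isGroup
  module KG = AS.IsGroup K.isGroup

record Graph : Set₁ where
  field
    V   : Set
    Adj : V → V → Set

open Graph public

SimpleGraph : Graph → Set
SimpleGraph X = (∀ u v → Adj X u v → Adj X v u) × (∀ v → ¬ Adj X v v)

FiniteGraph : Graph → Set
FiniteGraph X = Finite (V X)

Connected : Graph → Set
Connected X = ∀ u v → Star (Adj X) u v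

Nontrivial : Graph → Set
Nontrivial X = Σ (V X) λ u → Σ (V X) λ v → u ≢ v

record _≅_ (X Y : Graph) : Set where
  field
    to      : V X → V Y
    from    : V Y → V X
    from-to : ∀ v → from (to v) ≡ v
    to-from : ∀ w → to (from w) ≡ w
    adj     : ∀ u v → Adj X u v ⇔ Adj Y (to u) (to v)

Aut : Graph → Set
Aut X = X ≅ X

_□_ : Graph → Graph → Graph
X □ Y = record
  { V = V X × V Y
  ; Adj = λ { (u , x) (v , y) → (u ≡ v × Adj Y x y) ⊎ (x ≡ y × Adj X u v) } }

IsFactor : Graph → Graph → Set₁
IsFactor Z X = ∃[ X' ] (X ≅ (Z □ X'))

RelativelyPrime : Graph → Graph → Set₁
RelativelyPrime X Y =
  Nontrivial X × Nontrivial Y ×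
  (∀ (Z : Graph) → Nontrivial Z → IsFactor Z X → IsFactor Z Y → ⊥)

InverseClosed : (K : Grp) → Pred (El K) 0ℓ → Set
InverseClosed K T = ∀ t → t ∈ T → (t ⁻¹) ∈ T
  where open Grp K

Cay : (K : Grp) → Pred (El K) 0ℓ → Graph
Cay K T = record
  { V = El K
  ; Adj = λ g h → ∃[ t ] (t ∈ T × h ≡ t ∙ g) }
  where open Grp K

-- R(K) ⊴ Aut(Cay(K,T)), where R(k) : y ↦ y k
NormalCayley : (K : Grp) → (T : Pred (El K) 0ℓ) → Set
NormalCayley K T =
  ∀ (σ : Aut (Cay K T)) (k : El K) →
    ∃[ k' ] (∀ y → _≅_.to σ (y ∙ k) ≡ _≅_.to σ y ∙ k')
  where open Grp K

-- A group G acting (on the left) on V(X) via act, such that the image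
-- B = {act g} is a subgroup of Aut(X) isomorphic to G, normal in Aut(X),
-- semiregular, with exactly two orbits.

SameOrbit : (X : Graph) (G : Grp) → (El G → V X → V X) → V X → V X → Set
SameOrbit X G act u w = ∃[ g ] (act g u ≡ w)

record NormalBiCayleyAction (X : Graph) (G : Grp)
                            (act : El G → V X → V X) : Set₁ where
  open Grp G
  field
    act-ε       : ∀ v → act ε v ≡ v
    act-∙       : ∀ g h v → act (g ∙ h) v ≡ act g (act h v)
    faithful    : ∀ g → (∀ v → act g v ≡ v) → g ≡ ε
    act-aut     : ∀ g u v → Adj X u v ⇔ Adj X (act g u) (act g v)
    semiregular : ∀ g v → act g v ≡ v → ∀ w → act g w ≡ w
    twoOrbits   : ∃[ v₀ ] ∃[ v₁ ] ( ¬ SameOrbit X G act v₀ v₁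
                   × (∀ w → SameOrbit X G act v₀ w ⊎ SameOrbit X G act v₁ w))
    normal      : ∀ (σ : Aut X) g →
                    ∃[ g' ] (∀ v → _≅_.to σ (act g v) ≡ act g' (_≅_.to σ v))

-- the action of H × K on V(X) × K : (h , k) · (v , y) = (h · v , y k⁻¹),
-- whose image is exactly B × R(K)
prodAct : (X : Graph) (H K : Grp) → (El H → V X → V X) →
          El (H ×G K) → V X × El K → V X × El K
prodAct X H K act (h , k) (v , y) = (act h v , y ∙ (k ⁻¹))
  where open Grp K

-- An automorphism of X □ Y sending some Y-edge into an X-layer would, through the layer
-- decomposition of an isomorphism of Cartesian products, split off a nontrivial graph that is a
-- factor of both X and Y. So for relatively prime connected X and Y every automorphism maps layers
-- to layers and is a product α × β of automorphisms of X and Y. Normality of B in Aut X and of R(K)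
-- in Aut Y then yields normality of B × R(K); semiregularity and the two orbits pass through the
-- coordinates.
module Submission where

open import Defs
open import Level using (0ℓ)
open import Algebra.Bundles using (Group)
import Algebra.Properties.Group as GroupProperties
import Algebra.Structures as AS
open import Data.Empty using (⊥-elim)
open import Data.Product using (Σ; Σ-syntax; ∃-syntax; _×_; _,_; proj₁; proj₂; map; swap)
open import Data.Sum using (_⊎_; inj₁; inj₂)
import Data.Sum as Sum
open import Function using (id; _∘_; flip)
open import Function.Bundles using (_⇔_; mk⇔; Equivalence)
open import Function.Definitions using (Injective)
open import Function.Properties.Equivalence using (⇔-setoid)
import Function.Properties.Equivalence as ⇔
open import Relation.Nullary using (¬_)
open import Relation.Unary using (Pred; _∉_)
open import Relation.Binary.PropositionalEquality
open import Relation.Binary.PropositionalEquality.WithK using (≡-irrelevant)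
open import Relation.Binary.Construct.Closure.ReflexiveTransitive
  using (Star; _◅_; fold) renaming (ε to [])
import Relation.Binary.Reasoning.Setoid (⇔-setoid 0ℓ) as ⇔-Reasoning

Star-transport : {A : Set} {R : A → A → Set} (P : A → Set) →
                 (∀ {a b} → R a b → P a → P b) → ∀ {a b} → Star R a b → P a → P b
Star-transport P step = fold (λ a b → P a → P b) (λ r k → k ∘ step r) id

-- y is reachable from x, stored as a snoc list so that induction peels off the last step.
Reachable : {A : Set} → (A → A → Set) → A → A → Set
Reachable R x y = Star (flip R) y x

Loopless : Graph → Set
Loopless X = ∀ v → ¬ Adj X v v

Fibre : (X : Graph) {C : Set} → (V X → C) → C → Graph
Fibre X f c = record { V = Σ (V X) λ x → f x ≡ c ; Adj = λ u v → Adj X (proj₁ u) (proj₁ v) }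

fibre-≡ : {A C : Set} {f : A → C} {c : C} {a a' : A} {s : f a ≡ c} {s' : f a' ≡ c} →
          a ≡ a' → _≡_ {A = Σ A λ x → f x ≡ c} (a , s) (a' , s')
fibre-≡ {s = s} {s'} refl = cong (_ ,_) (≡-irrelevant s s')

module Iso {X Y : Graph} (ψ : X ≅ Y) where
  open _≅_ ψ public

  to-adj : ∀ {u v} → Adj X u v → Adj Y (to u) (to v)
  to-adj = Equivalence.to (adj _ _)

  to-injective : Injective _≡_ _≡_ to
  to-injective {u} {v} e = trans (sym (from-to u)) (trans (cong from e) (from-to v))

  from-adj⇔ : ∀ w w' → Adj Y w w' ⇔ Adj X (from w) (from w')
  from-adj⇔ w w' = begin
    Adj Y w w'                          ≡⟨ cong₂ (Adj Y) (to-from w) (to-from w') ⟨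
    Adj Y (to (from w)) (to (from w'))  ≈⟨ adj (from w) (from w') ⟨
    Adj X (from w) (from w')            ∎
    where open ⇔-Reasoning

  from-adj : ∀ {w w'} → Adj Y w w' → Adj X (from w) (from w')
  from-adj = Equivalence.to (from-adj⇔ _ _)

≅-sym : {X Y : Graph} → X ≅ Y → Y ≅ X
≅-sym ψ = record { to = from ; from = to ; from-to = to-from ; to-from = from-to ; adj = from-adj⇔ }
  where open Iso ψ

≅-trans : {X Y Z : Graph} → X ≅ Y → Y ≅ Z → X ≅ Z
≅-trans ψ χ = record
  { to      = χ.to ∘ ψ.to
  ; from    = ψ.from ∘ χ.from
  ; from-to = λ x → trans (cong ψ.from (χ.from-to (ψ.to x))) (ψ.from-to x)
  ; to-from = λ z → trans (cong χ.to (ψ.to-from (χ.from z))) (χ.to-from z)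
  ; adj     = λ u v → ⇔.trans (ψ.adj u v) (χ.adj (ψ.to u) (ψ.to v)) }
  where
  module ψ = Iso ψ
  module χ = Iso χ

□-map-adj⇔ : {X X' Y Y' : Graph} {f : V X → V X'} {g : V Y → V Y'} →
             Injective _≡_ _≡_ f → Injective _≡_ _≡_ g →
             (∀ u v → Adj X u v ⇔ Adj X' (f u) (f v)) →
             (∀ u v → Adj Y u v ⇔ Adj Y' (g u) (g v)) →
             ∀ w w' → Adj (X □ Y) w w' ⇔ Adj (X' □ Y') (map f g w) (map f g w')
□-map-adj⇔ {X} {X'} {Y} {Y'} {f} {g} f-inj g-inj f-adj g-adj w w' = mk⇔ forward backward
  where
  forward : Adj (X □ Y) w w' → Adj (X' □ Y') (map f g w) (map f g w')
  forward (inj₁ (e , a)) = inj₁ (cong f e , Equivalence.to (g-adj _ _) a)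
  forward (inj₂ (e , a)) = inj₂ (cong g e , Equivalence.to (f-adj _ _) a)
  backward : Adj (X' □ Y') (map f g w) (map f g w') → Adj (X □ Y) w w'
  backward (inj₁ (e , a)) = inj₁ (f-inj e , Equivalence.from (g-adj _ _) a)
  backward (inj₂ (e , a)) = inj₂ (g-inj e , Equivalence.from (f-adj _ _) a)

□-comm : {X Y : Graph} → (X □ Y) ≅ (Y □ X)
□-comm = record
  { to = swap ; from = swap ; from-to = λ _ → refl ; to-from = λ _ → refl
  ; adj = λ _ _ → mk⇔ Sum.swap Sum.swap }

□-congˡ : {X X' Y : Graph} → X ≅ X' → (X □ Y) ≅ (X' □ Y)
□-congˡ {X} {X'} {Y} ψ = record
  { to      = map to id
  ; from    = map from id
  ; from-to = λ w → cong (_, proj₂ w) (from-to (proj₁ w))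
  ; to-from = λ w → cong (_, proj₂ w) (to-from (proj₁ w))
  ; adj     = □-map-adj⇔ {X} {X'} {Y} {Y} to-injective id adj (λ _ _ → ⇔.refl) }
  where open Iso ψ

layerˣ-adj⇔ : (X Y : Graph) → Loopless Y → ∀ {u v y} → Adj X u v ⇔ Adj (X □ Y) (u , y) (v , y)
layerˣ-adj⇔ _ _ loopless {y = y} = mk⇔ (λ a → inj₂ (refl , a)) λ
  { (inj₁ (_ , a)) → ⊥-elim (loopless y a)
  ; (inj₂ (_ , a)) → a }

layerʸ-adj⇔ : (X Y : Graph) → Loopless X → ∀ {x y y'} → Adj Y y y' ⇔ Adj (X □ Y) (x , y) (x , y')
layerʸ-adj⇔ _ _ loopless {x = x} = mk⇔ (λ a → inj₁ (refl , a)) λ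
  { (inj₁ (_ , a)) → a
  ; (inj₂ (_ , a)) → ⊥-elim (loopless x a) }

Fibre-□-adj⇔ : {X Y : Graph} {C D : Set} {f : V X → C} {g : V Y → D} {c : C} {d : D}
               (w w' : V (Fibre X f c □ Fibre Y g d)) →
               Adj (Fibre X f c □ Fibre Y g d) w w' ⇔
               Adj (X □ Y) (proj₁ (proj₁ w) , proj₁ (proj₂ w)) (proj₁ (proj₁ w') , proj₁ (proj₂ w'))
Fibre-□-adj⇔ _ _ = mk⇔ (Sum.map (map (cong proj₁) id) (map (cong proj₁) id))
                       (Sum.map (map fibre-≡ id) (map fibre-≡ id))

-- For φ : P □ Q ≅ R □ U, the preimage of the R-layer through b is the product of its two slices
-- through (p₀, q₀), so R factors.

module Layer {P Q R U : Graph} (φ : (P □ Q) ≅ (R □ U))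
             (simpleP : SimpleGraph P) (simpleQ : SimpleGraph Q) (looplessU : Loopless U)
             (connectedR : Connected R)
             (b : V U) (p₀ : V P) (q₀ : V Q) (base : proj₂ (_≅_.to φ (p₀ , q₀)) ≡ b) where
  open Iso φ

  InLayer : V P → V Q → Set
  InLayer p q = proj₂ (to (p , q)) ≡ b

  -- Of the two edges at (p', q'), at most one can map to a U-edge: otherwise φ(p', q) = φ(p, q').
  -- An R-edge keeps the U-coordinate b.
  layer-square : ∀ {p p' q q'} → Adj P p p' → Adj Q q q' →
                 InLayer p q → InLayer p' q → InLayer p q' → InLayer p' q'
  layer-square {p} {p'} {q} {q'} pp' qq' _ p'q pq'
    with to-adj {p' , q'} {p' , q} (inj₁ (refl , proj₁ simpleQ _ _ qq'))
       | to-adj {p' , q'} {p , q'} (inj₂ (refl , proj₁ simpleP _ _ pp'))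
  ... | inj₂ (e , _) | _             = trans e p'q
  ... | inj₁ _       | inj₂ (e , _)  = trans e pq'
  ... | inj₁ (e , _) | inj₁ (e' , _) = ⊥-elim (proj₂ simpleP p (subst (Adj P p) (cong proj₁ collapse) pp'))
    where
    collapse : (p' , q) ≡ (p , q')
    collapse = to-injective (cong₂ _,_ (trans (sym e) e') (trans p'q (sym pq')))

  S₁ : V P → Set
  S₁ p = InLayer p q₀

  S₂ : V Q → Set
  S₂ q = InLayer p₀ q

  Reach₁ : V P → Set
  Reach₁ = Reachable (λ p p' → Adj P p p' × S₁ p') p₀

  Reach₂ : V Q → Set
  Reach₂ = Reachable (λ q q' → Adj Q q q' × S₂ q') q₀

  Reach₁⊆S₁ : ∀ {p} → Reach₁ p → S₁ p
  Reach₁⊆S₁ []            = base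
  Reach₁⊆S₁ ((_ , s) ◅ _) = s

  Reach₂⊆S₂ : ∀ {q} → Reach₂ q → S₂ q
  Reach₂⊆S₂ []            = base
  Reach₂⊆S₂ ((_ , s) ◅ _) = s

  Reach⊆layer : ∀ {p q} → Reach₁ p → Reach₂ q → InLayer p q
  Reach⊆layer rp []                          = Reach₁⊆S₁ rp
  Reach⊆layer {q = q'} rp ((qq' , s) ◅ rq) = extend rp
    where
    extend : ∀ {p} → Reach₁ p → InLayer p q'
    extend []                = s
    extend (step@(pp' , _) ◅ rp') =
      layer-square pp' qq' (Reach⊆layer rp' rq) (Reach⊆layer (step ◅ rp') rq) (extend rp')

  Reach₂-closed : ∀ {p q q'} → Reach₁ p → Reach₂ q → Adj Q q q' → InLayer p q' → S₂ q'
  Reach₂-closed []                     _  _   pq' = pq'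
  Reach₂-closed (step@(pp' , _) ◅ rp) rq qq' pq' =
    Reach₂-closed rp rq qq'
      (layer-square (proj₁ simpleP _ _ pp') qq' (Reach⊆layer (step ◅ rp) rq) (Reach⊆layer rp rq) pq')

  Reach₁-closed : ∀ {p p' q} → Reach₁ p → Reach₂ q → Adj P p p' → InLayer p' q → S₁ p'
  Reach₁-closed _  []                     _   p'q = p'q
  Reach₁-closed rp (step@(qq' , _) ◅ rq) pp' p'q =
    Reach₁-closed rp rq pp'
      (layer-square pp' (proj₁ simpleQ _ _ qq') (Reach⊆layer rp (step ◅ rq)) p'q (Reach⊆layer rp rq))

  InReach : V P × V Q → Set
  InReach w = Reach₁ (proj₁ w) × Reach₂ (proj₂ w)

  point : V R → V P × V Q
  point r = from (r , b)

  point∈layer : ∀ r → InLayer (proj₁ (point r)) (proj₂ (point r))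
  point∈layer r = cong proj₂ (to-from (r , b))

  point-to : ∀ {p q} → InLayer p q → point (proj₁ (to (p , q))) ≡ (p , q)
  point-to {p} {q} pq = trans (cong (λ u → from (proj₁ (to (p , q)) , u)) (sym pq)) (from-to (p , q))

  -- An R-edge of the layer pulls back to a P- or a Q-edge, which stays inside the reachable sets.
  InReach-step : ∀ {r r'} → Adj R r r' → InReach (point r) → InReach (point r')
  InReach-step {r} {r'} rr' (rp , rq) with from-adj {r , b} {r' , b} (inj₂ (refl , rr'))
  ... | inj₁ (pp , qq') =
    subst Reach₁ pp rp ,
    (qq' , Reach₂-closed rp rq qq' (subst (λ p → InLayer p (proj₂ (point r'))) (sym pp) (point∈layer r'))) ◅ rq
  ... | inj₂ (qq , pp') =
    (pp' , Reach₁-closed rp rq pp' (subst (InLayer (proj₁ (point r'))) (sym qq) (point∈layer r'))) ◅ rp ,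
    subst Reach₂ qq rq

  point-InReach : ∀ r → InReach (point r)
  point-InReach r = Star-transport (InReach ∘ point) InReach-step
    (connectedR (proj₁ (to (p₀ , q₀))) r) (subst InReach (sym (point-to base)) ([] , []))

  layer⊆Reach : ∀ {p q} → InLayer p q → InReach (p , q)
  layer⊆Reach pq = subst InReach (point-to pq) (point-InReach _)

  Factor₁ : Graph
  Factor₁ = Fibre P (λ p → proj₂ (to (p , q₀))) b

  Factor₂ : Graph
  Factor₂ = Fibre Q (λ q → proj₂ (to (p₀ , q))) b

  embed : V R → V (Factor₁ □ Factor₂)
  embed r = (proj₁ (point r) , Reach₁⊆S₁ (proj₁ (point-InReach r))) ,
            (proj₂ (point r) , Reach₂⊆S₂ (proj₂ (point-InReach r)))

  layer-≅ : R ≅ (Factor₁ □ Factor₂)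
  layer-≅ = record
    { to      = embed
    ; from    = λ w → proj₁ (to (proj₁ (proj₁ w) , proj₁ (proj₂ w)))
    ; from-to = λ r → cong proj₁ (to-from (r , b))
    ; to-from = λ { ((p , p∈S₁) , (q , q∈S₂)) →
        let e = point-to (Reach⊆layer (proj₁ (layer⊆Reach p∈S₁)) (proj₂ (layer⊆Reach q∈S₂)))
        in cong₂ _,_ (fibre-≡ (cong proj₁ e)) (fibre-≡ (cong proj₂ e)) }
    ; adj     = λ r r' → begin
        Adj R r r'                          ≈⟨ layerˣ-adj⇔ R U looplessU ⟩
        Adj (R □ U) (r , b) (r' , b)        ≈⟨ from-adj⇔ (r , b) (r' , b) ⟩
        Adj (P □ Q) (point r) (point r')    ≈⟨ Fibre-□-adj⇔ {P} {Q} (embed r) (embed r') ⟨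
        Adj (Factor₁ □ Factor₂) (embed r) (embed r') ∎ }
    where open ⇔-Reasoning

-- Automorphisms of a product of relatively prime graphs

layerIntersection-≅ : {A B C D : Graph} (φ : (A □ B) ≅ (C □ D)) → Loopless A → Loopless D →
                      (a : V A) (d : V D) →
                      Fibre B (λ q → proj₂ (_≅_.to φ (a , q))) d ≅ Fibre C (λ p → proj₁ (_≅_.from φ (p , d))) a
layerIntersection-≅ {A} {B} {C} {D} φ looplessA looplessD a d = record
  { to      = λ (q , s) → proj₁ (to (a , q)) , cong proj₁ (from-to-fibre s)
  ; from    = λ (p , s) → proj₂ (from (p , d)) , cong proj₂ (to-from-fibre s)
  ; from-to = λ (q , s) → fibre-≡ (cong proj₂ (from-to-fibre s))
  ; to-from = λ (p , s) → fibre-≡ (cong proj₁ (to-from-fibre s))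
  ; adj     = λ (q , s) (q' , s') → begin
      Adj B q q'                                          ≈⟨ layerʸ-adj⇔ A B looplessA ⟩
      Adj (A □ B) (a , q) (a , q')                        ≈⟨ adj (a , q) (a , q') ⟩
      Adj (C □ D) (to (a , q)) (to (a , q'))              ≡⟨ cong₂ (Adj (C □ D)) (cong (_ ,_) s) (cong (_ ,_) s') ⟩
      Adj (C □ D) (proj₁ (to (a , q)) , d) (proj₁ (to (a , q')) , d) ≈⟨ layerˣ-adj⇔ C D looplessD ⟨
      Adj C (proj₁ (to (a , q))) (proj₁ (to (a , q')))    ∎ }
  where
  open Iso φ
  open ⇔-Reasoning

  from-to-fibre : ∀ {q} → proj₂ (to (a , q)) ≡ d → from (proj₁ (to (a , q)) , d) ≡ (a , q)
  from-to-fibre {q} s = trans (cong (λ u → from (proj₁ (to (a , q)) , u)) (sym s)) (from-to (a , q))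

  to-from-fibre : ∀ {p} → proj₁ (from (p , d)) ≡ a → to (a , proj₂ (from (p , d))) ≡ (p , d)
  to-from-fibre {p} s = trans (cong (λ u → to (u , proj₂ (from (p , d)))) (sym s)) (to-from (p , d))

Splits : {X Y : Graph} → Aut (X □ Y) → Set
Splits {X} {Y} σ = Σ[ α ∈ Aut X ] Σ[ β ∈ Aut Y ] (∀ x y → _≅_.to σ (x , y) ≡ (_≅_.to α x , _≅_.to β y))

module _ {X Y : Graph} (simpleX : SimpleGraph X) (simpleY : SimpleGraph Y)
         (connectedX : Connected X) (connectedY : Connected Y)
         (coprime : RelativelyPrime X Y) where

  -- If σ maps the Y-edge {(x, y), (x, y')} into an X-layer, the layer decomposition of σ
  -- and of σ⁻¹ exhibits the nontrivial graph Z below as a common factor of X and Y.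
  Y-edge-image-leaves-X-layer : (σ : Aut (X □ Y)) → ∀ {x y y'} → Adj Y y y' →
                                proj₂ (_≅_.to σ (x , y)) ≢ proj₂ (_≅_.to σ (x , y'))
  Y-edge-image-leaves-X-layer σ {x} {y} {y'} yy' same =
    proj₂ (proj₂ coprime) Z Z-nontrivial
      (L.Factor₁ , ≅-trans L.layer-≅ □-comm)
      (L⁻¹.Factor₂ , ≅-trans L⁻¹.layer-≅ (□-congˡ (≅-sym Z≅)))
    where
    open Iso σ
    b = proj₂ (to (x , y))
    module L   = Layer σ simpleX simpleY (proj₂ simpleY) connectedX b x y refl
    module L⁻¹ = Layer (≅-trans (≅-sym σ) □-comm) simpleX simpleY (proj₂ simpleX) connectedY
                       x (proj₁ (to (x , y))) b (cong proj₁ (from-to (x , y)))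
    Z : Graph
    Z = L.Factor₂
    Z≅ : Z ≅ L⁻¹.Factor₁
    Z≅ = layerIntersection-≅ σ (proj₂ simpleX) (proj₂ simpleY) x b
    Z-nontrivial : Nontrivial Z
    Z-nontrivial = (y , refl) , (y' , sym same) ,
                   λ e → proj₂ simpleY y (subst (Adj Y y) (sym (cong proj₁ e)) yy')

  aut-preserves-Y-layers : (σ : Aut (X □ Y)) → ∀ {x y y'} → Adj Y y y' →
                           proj₁ (_≅_.to σ (x , y)) ≡ proj₁ (_≅_.to σ (x , y'))
  aut-preserves-Y-layers σ {x} {y} {y'} yy' with Iso.to-adj σ {x , y} {x , y'} (inj₁ (refl , yy'))
  ... | inj₁ (e , _) = e
  ... | inj₂ (e , _) = ⊥-elim (Y-edge-image-leaves-X-layer σ yy' e)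

  aut-preserves-X-layers : (σ : Aut (X □ Y)) → ∀ {x x' y} → Adj X x x' →
                           proj₂ (_≅_.to σ (x , y)) ≡ proj₂ (_≅_.to σ (x' , y))
  aut-preserves-X-layers σ {x} {x'} {y} xx' with Iso.to-adj σ {x , y} {x' , y} (inj₂ (refl , xx'))
  ... | inj₂ (e , _)  = e
  ... | inj₁ (e , yy) = ⊥-elim (Y-edge-image-leaves-X-layer (≅-sym σ) yy (begin
    proj₂ (from (proj₁ (to (x , y)) , proj₂ (to (x , y))))   ≡⟨ cong proj₂ (from-to (x , y)) ⟩
    y                                                        ≡⟨ cong proj₂ (from-to (x' , y)) ⟨
    proj₂ (from (to (x' , y)))                               ≡⟨ cong (λ u → proj₂ (from (u , proj₂ (to (x' , y))))) e ⟨
    proj₂ (from (proj₁ (to (x , y)) , proj₂ (to (x' , y)))) ∎))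
    where
    open Iso σ
    open ≡-Reasoning

  private
    x* : V X
    x* = proj₁ (proj₁ coprime)

    y* : V Y
    y* = proj₁ (proj₁ (proj₂ coprime))

  α : Aut (X □ Y) → V X → V X
  α σ x = proj₁ (_≅_.to σ (x , y*))

  β : Aut (X □ Y) → V Y → V Y
  β σ y = proj₂ (_≅_.to σ (x* , y))

  to≡α×β : ∀ σ x y → _≅_.to σ (x , y) ≡ (α σ x , β σ y)
  to≡α×β σ x y = cong₂ _,_
    (Star-transport (λ y' → proj₁ (to (x , y)) ≡ proj₁ (to (x , y')))
                    (λ yy' e → trans e (aut-preserves-Y-layers σ yy')) (connectedY y y*) refl)
    (Star-transport (λ x' → proj₂ (to (x , y)) ≡ proj₂ (to (x' , y)))
                    (λ xx' e → trans e (aut-preserves-X-layers σ xx')) (connectedX x x*) refl)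
    where open _≅_ σ

  α-inverse : ∀ σ x → α (≅-sym σ) (α σ x) ≡ x
  α-inverse σ x = cong proj₁ (begin
    (α (≅-sym σ) (α σ x) , β (≅-sym σ) (β σ y*))  ≡⟨ to≡α×β (≅-sym σ) _ _ ⟨
    from (α σ x , β σ y*)                          ≡⟨ cong from (to≡α×β σ x y*) ⟨
    from (to (x , y*))                             ≡⟨ from-to (x , y*) ⟩
    (x , y*)                                       ∎)
    where
    open _≅_ σ
    open ≡-Reasoning

  β-inverse : ∀ σ y → β (≅-sym σ) (β σ y) ≡ y
  β-inverse σ y = cong proj₂ (begin
    (α (≅-sym σ) (α σ x*) , β (≅-sym σ) (β σ y))  ≡⟨ to≡α×β (≅-sym σ) _ _ ⟨
    from (α σ x* , β σ y)                          ≡⟨ cong from (to≡α×β σ x* y) ⟨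
    from (to (x* , y))                             ≡⟨ from-to (x* , y) ⟩
    (x* , y)                                       ∎)
    where
    open _≅_ σ
    open ≡-Reasoning

  α-aut : Aut (X □ Y) → Aut X
  α-aut σ = record
    { to = α σ ; from = α (≅-sym σ) ; from-to = α-inverse σ ; to-from = α-inverse (≅-sym σ)
    ; adj = λ u v → begin
        Adj X u v                                   ≈⟨ layerˣ-adj⇔ X Y (proj₂ simpleY) ⟩
        Adj (X □ Y) (u , y*) (v , y*)               ≈⟨ _≅_.adj σ (u , y*) (v , y*) ⟩
        Adj (X □ Y) (_≅_.to σ (u , y*)) (_≅_.to σ (v , y*))
                                                    ≡⟨ cong₂ (Adj (X □ Y)) (to≡α×β σ u y*) (to≡α×β σ v y*) ⟩
        Adj (X □ Y) (α σ u , β σ y*) (α σ v , β σ y*) ≈⟨ layerˣ-adj⇔ X Y (proj₂ simpleY) ⟨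
        Adj X (α σ u) (α σ v)                       ∎ }
    where open ⇔-Reasoning

  β-aut : Aut (X □ Y) → Aut Y
  β-aut σ = record
    { to = β σ ; from = β (≅-sym σ) ; from-to = β-inverse σ ; to-from = β-inverse (≅-sym σ)
    ; adj = λ u v → begin
        Adj Y u v                                   ≈⟨ layerʸ-adj⇔ X Y (proj₂ simpleX) ⟩
        Adj (X □ Y) (x* , u) (x* , v)               ≈⟨ _≅_.adj σ (x* , u) (x* , v) ⟩
        Adj (X □ Y) (_≅_.to σ (x* , u)) (_≅_.to σ (x* , v))
                                                    ≡⟨ cong₂ (Adj (X □ Y)) (to≡α×β σ x* u) (to≡α×β σ x* v) ⟩
        Adj (X □ Y) (α σ x* , β σ u) (α σ x* , β σ v) ≈⟨ layerʸ-adj⇔ X Y (proj₂ simpleX) ⟨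
        Adj Y (β σ u) (β σ v)                       ∎ }
    where open ⇔-Reasoning

  Aut-□-splits : (σ : Aut (X □ Y)) → Splits σ
  Aut-□-splits σ = α-aut σ , β-aut σ , to≡α×β σ

-- Groups, Cayley graphs and the product action

Grp→Group : Grp → Group 0ℓ 0ℓ
Grp→Group G = record { isGroup = Grp.isGroup G }

module GrpProperties (G : Grp) where
  open Grp G public
  open AS.IsGroup isGroup public using (assoc; identityˡ; identityʳ; inverseˡ)
  open GroupProperties (Grp→Group G) public
    using (ε⁻¹≈ε; ⁻¹-involutive; ⁻¹-anti-homo-∙; ∙-cancelʳ; identityʳ-unique)

  ⁻¹≡ε⇒≡ε : ∀ {k} → k ⁻¹ ≡ ε → k ≡ ε
  ⁻¹≡ε⇒≡ε {k} e = trans (sym (⁻¹-involutive k)) (trans (cong _⁻¹ e) ε⁻¹≈ε)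

module _ (K : Grp) (T : Pred (El K) 0ℓ) where
  open GrpProperties K

  Cay-simple : InverseClosed K T → ε ∉ T → SimpleGraph (Cay K T)
  Cay-simple inverseClosed ε∉T = symmetric , loopless
    where
    symmetric : ∀ u v → Adj (Cay K T) u v → Adj (Cay K T) v u
    symmetric u v (t , t∈T , v≡tu) = t ⁻¹ , inverseClosed t t∈T , (begin
      u                ≡⟨ identityˡ u ⟨
      ε ∙ u            ≡⟨ cong (_∙ u) (inverseˡ t) ⟨
      (t ⁻¹ ∙ t) ∙ u   ≡⟨ assoc (t ⁻¹) t u ⟩
      t ⁻¹ ∙ (t ∙ u)   ≡⟨ cong (t ⁻¹ ∙_) v≡tu ⟨
      t ⁻¹ ∙ v         ∎)
      where open ≡-Reasoning
    loopless : ∀ v → ¬ Adj (Cay K T) v v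
    loopless v (t , t∈T , v≡tv) = ε∉T (subst T (∙-cancelʳ v t ε (trans (sym v≡tv) (sym (identityˡ v)))) t∈T)

  Cay-∙ʳ-adj⇔ : ∀ k u v → Adj (Cay K T) u v ⇔ Adj (Cay K T) (u ∙ k) (v ∙ k)
  Cay-∙ʳ-adj⇔ k u v = mk⇔
    (λ (t , t∈T , e) → t , t∈T , trans (cong (_∙ k) e) (assoc t u k))
    (λ (t , t∈T , e) → t , t∈T , ∙-cancelʳ k v (t ∙ u) (trans e (sym (assoc t u k))))

act-injective : {X : Graph} {H : Grp} {act : El H → V X → V X} →
                NormalBiCayleyAction X H act → ∀ h → Injective _≡_ _≡_ (act h)
act-injective {H = H} {act} B h {u} {v} e = begin
  u                        ≡⟨ act-ε u ⟨
  act ε u                  ≡⟨ cong (λ g → act g u) (inverseˡ h) ⟨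
  act (h ⁻¹ ∙ h) u         ≡⟨ act-∙ (h ⁻¹) h u ⟩
  act (h ⁻¹) (act h u)     ≡⟨ cong (act (h ⁻¹)) e ⟩
  act (h ⁻¹) (act h v)     ≡⟨ act-∙ (h ⁻¹) h v ⟨
  act (h ⁻¹ ∙ h) v         ≡⟨ cong (λ g → act g v) (inverseˡ h) ⟩
  act ε v                  ≡⟨ act-ε v ⟩
  v                        ∎
  where
  open GrpProperties H
  open NormalBiCayleyAction B
  open ≡-Reasoning

module ProductAction (H K : Grp) {X : Graph} {act : El H → V X → V X}
                     (B : NormalBiCayleyAction X H act) (T : Pred (El K) 0ℓ) where
  private
    module H = GrpProperties H
    module B = NormalBiCayleyAction B
    open GrpProperties K

    Y : Graph
    Y = Cay K T

    ρ : El (H ×G K) → V (X □ Y) → V (X □ Y)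
    ρ = prodAct X H K act

    y∙k⁻¹≡y⇒k≡ε : ∀ {k} y → y ∙ k ⁻¹ ≡ y → k ≡ ε
    y∙k⁻¹≡y⇒k≡ε {k} y e = ⁻¹≡ε⇒≡ε (identityʳ-unique y (k ⁻¹) e)

  ρ-ε : ∀ w → ρ (Grp.ε (H ×G K)) w ≡ w
  ρ-ε (v , y) = cong₂ _,_ (B.act-ε v) (trans (cong (y ∙_) ε⁻¹≈ε) (identityʳ y))

  ρ-∙ : ∀ g g' w → ρ (Grp._∙_ (H ×G K) g g') w ≡ ρ g (ρ g' w)
  ρ-∙ (h , k) (h' , k') (v , y) = cong₂ _,_ (B.act-∙ h h' v) (begin
    y ∙ (k ∙ k') ⁻¹         ≡⟨ cong (y ∙_) (⁻¹-anti-homo-∙ k k') ⟩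
    y ∙ (k' ⁻¹ ∙ k ⁻¹)      ≡⟨ assoc y (k' ⁻¹) (k ⁻¹) ⟨
    y ∙ k' ⁻¹ ∙ k ⁻¹        ∎)
    where open ≡-Reasoning

  ρ-faithful : ∀ g → (∀ w → ρ g w ≡ w) → g ≡ Grp.ε (H ×G K)
  ρ-faithful (h , k) fixes = cong₂ _,_
    (B.faithful h (λ v → cong proj₁ (fixes (v , ε))))
    (y∙k⁻¹≡y⇒k≡ε ε (cong proj₂ (fixes (proj₁ B.twoOrbits , ε))))

  ρ-aut : ∀ g u v → Adj (X □ Y) u v ⇔ Adj (X □ Y) (ρ g u) (ρ g v)
  ρ-aut (h , k) = □-map-adj⇔ {X} {X} {Y} {Y} (act-injective B h) (λ {y} {y'} → ∙-cancelʳ (k ⁻¹) y y')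
                             (B.act-aut h) (Cay-∙ʳ-adj⇔ K T (k ⁻¹))

  ρ-semiregular : ∀ g w → ρ g w ≡ w → ∀ w' → ρ g w' ≡ w'
  ρ-semiregular (h , k) (v , y) fixes (v' , y') = cong₂ _,_
    (B.semiregular h v (cong proj₁ fixes) v')
    (trans (cong (λ k → y' ∙ k ⁻¹) (y∙k⁻¹≡y⇒k≡ε y (cong proj₂ fixes))) (cong proj₂ (ρ-ε (v' , y'))))

  orbit-lift : ∀ {u v} → SameOrbit X H act u v → ∀ y → SameOrbit (X □ Y) (H ×G K) ρ (u , ε) (v , y)
  orbit-lift (h , e) y = (h , y ⁻¹) , cong₂ _,_ e (trans (identityˡ _) (⁻¹-involutive y))

  ρ-twoOrbits : ∃[ w₀ ] ∃[ w₁ ] (¬ SameOrbit (X □ Y) (H ×G K) ρ w₀ w₁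
                  × (∀ w → SameOrbit (X □ Y) (H ×G K) ρ w₀ w ⊎ SameOrbit (X □ Y) (H ×G K) ρ w₁ w))
  ρ-twoOrbits with B.twoOrbits
  ... | v₀ , v₁ , separate , cover =
    (v₀ , ε) , (v₁ , ε) ,
    (λ ((h , _) , e) → separate (h , cong proj₁ e)) ,
    λ (v , y) → Sum.map (λ o → orbit-lift o y) (λ o → orbit-lift o y) (cover v)

  ρ-normal : NormalCayley K T → (∀ (σ : Aut (X □ Y)) → Splits σ) →
             ∀ (σ : Aut (X □ Y)) g → ∃[ g' ] (∀ w → _≅_.to σ (ρ g w) ≡ ρ g' (_≅_.to σ w))
  ρ-normal normalY splits σ (h , k) with splits σ
  ... | α , β , σ≡α×β with B.normal α h | normalY β (k ⁻¹)
  ... | h' , α-conj | k' , β-conj = (h' , k' ⁻¹) , λ (v , y) → begin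
    _≅_.to σ (act h v , y ∙ k ⁻¹)                   ≡⟨ σ≡α×β (act h v) (y ∙ k ⁻¹) ⟩
    (_≅_.to α (act h v) , _≅_.to β (y ∙ k ⁻¹))      ≡⟨ cong₂ _,_ (α-conj v) (β-conj y) ⟩
    (act h' (_≅_.to α v) , _≅_.to β y ∙ k')          ≡⟨ cong (λ k'' → (_ , _≅_.to β y ∙ k'')) (⁻¹-involutive k') ⟨
    ρ (h' , k' ⁻¹) (_≅_.to α v , _≅_.to β y)         ≡⟨ cong (ρ (h' , k' ⁻¹)) (σ≡α×β v y) ⟨
    ρ (h' , k' ⁻¹) (_≅_.to σ (v , y))                ∎
    where open ≡-Reasoning

theorem2p4 : (H K : Grp) → Finite (El H) → Finite (El K) →
    (X : Graph) → SimpleGraph X → FiniteGraph X → Connected X →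
    (act : El H → V X → V X) → NormalBiCayleyAction X H act →
    (T : Pred (El K) 0ℓ) → InverseClosed K T → Grp.ε K ∉ T →
    Connected (Cay K T) → NormalCayley K T →
    RelativelyPrime X (Cay K T) →
    NormalBiCayleyAction (X □ Cay K T) (H ×G K) (prodAct X H K act)
theorem2p4 H K _ _ X simpleX _ connectedX act B T inverseClosed ε∉T connectedY normalY coprime = record
  { act-ε       = ρ-ε
  ; act-∙       = ρ-∙
  ; faithful    = ρ-faithful
  ; act-aut     = ρ-aut
  ; semiregular = ρ-semiregular
  ; twoOrbits   = ρ-twoOrbits
  ; normal      = ρ-normal normalY
      (Aut-□-splits simpleX (Cay-simple K T inverseClosed ε∉T) connectedX connectedY coprime) }
  where open ProductAction H K B T
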